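{- Let $H$ be a hypergraph, $e = \{v_1,\ldots,v_m\}$ an edge of $H$, and let $H_e = (H \setminus \{e\}) \cup \{\{w,u_1\},\ldots,\{w,u_m\},\{u_1,v_1\},\ldots,\{u_m,v_m\}\}$ where $w, u_1, \ldots, u_m$ are new vertices not in $V(H)$. If $H$ has no Berge cycle of length divisible by $3$, then neither does $H_e$.
   Context: A hypergraph $H$ on a finite set $V=V(H)$ is a collection of nonempty subsets of $V$, called edges. Standing convention: every edge is inclusion-minimal and has size at least $2$. A Berge cycle of length $\ell$ is an alternating sequence $x_1 f_1 x_2 f_2 \cdots x_\ell f_\ell$ of $\ell$ distinct vertices and $\ell$ distinct edges with $x_j, x_{j+1} \in f_j$ (indices mod $\ell$). -}

module Defs where

open import Data.Nat using (ℕ; zero; suc; _+_; _≤_; _%_)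
open import Data.Nat.DivMod using (m%n<n)
open import Data.Nat.Divisibility using (_∣_)
open import Data.Fin using (Fin; toℕ; fromℕ<; _↑ˡ_; _↑ʳ_) renaming (zero to fzero; suc to fsuc)
open import Data.Fin.Subset using (Subset; _∈_; _⊆_; ⁅_⁆; _∪_; ∣_∣; outside)
open import Data.Bool using (Bool)
import Data.Bool as B
open import Data.Vec using (_++_; replicate)
open import Data.Vec.Properties using (≡-dec)
open import Data.List using (List; length; lookup; map; filter; allFin) renaming (_++_ to _++ₗ_)
open import Data.List.Relation.Unary.Unique.Propositional using (Unique)
open import Data.Product using (Σ; ∃; _×_)
open import Function using (_∘_; _⇔_)
open import Function.Definitions using (Injective)
open import Relation.Binary.PropositionalEquality using (_≡_)
open import Relation.Nullary using (¬?)

_≟ˢ_ : ∀ {n} (a b : Subset n) → Relation.Nullary.Dec (a ≡ b)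
_≟ˢ_ = ≡-dec B._≟_

record IsHypergraph {n : ℕ} (Es : List (Subset n)) : Set where
  field
    distinct  : Unique Es
    size≥2    : ∀ i → 2 ≤ ∣ lookup Es i ∣
    minimal   : ∀ i j → lookup Es i ⊆ lookup Es j → lookup Es i ≡ lookup Es j

next : ∀ {ℓ} → Fin ℓ → Fin ℓ
next {suc k} i = fromℕ< (m%n<n (suc (toℕ i)) (suc k))

record BergeCycle {n : ℕ} (Es : List (Subset n)) (ℓ : ℕ) : Set where
  field
    len≥2     : 2 ≤ ℓ
    x         : Fin ℓ → Fin n
    f         : Fin ℓ → Fin (length Es)
    x-inj     : Injective _≡_ _≡_ x
    f-inj     : Injective _≡_ _≡_ (lookup Es ∘ f)
    x∈f       : ∀ j → x j ∈ lookup Es (f j)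
    xnext∈f   : ∀ j → x (next j) ∈ lookup Es (f j)

HasCycleDiv3 : ∀ {n} → List (Subset n) → Set
HasCycleDiv3 Es = Σ ℕ (λ ℓ → (3 ∣ ℓ) × BergeCycle Es ℓ)

-- The construction H_e.  Given an edge e and an enumeration
-- v : Fin m → Fin n of e = {v_1,…,v_m}, the new vertex set is Fin (n + suc m):
-- old vertices via inject+, w = n, u_i = n + 1 + i.
module Construction {n m : ℕ} (e : Subset n) (v : Fin m → Fin n) where
  old : Fin n → Fin (n + suc m)
  old i = i ↑ˡ suc m

  w : Fin (n + suc m)
  w = n ↑ʳ fzero

  u : Fin m → Fin (n + suc m)
  u i = n ↑ʳ fsuc i

  lift : Subset n → Subset (n + suc m)
  lift s = s ++ replicate (suc m) outside

  pair : Fin (n + suc m) → Fin (n + suc m) → Subset (n + suc m)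
  pair a b = ⁅ a ⁆ ∪ ⁅ b ⁆

  He : List (Subset n) → List (Subset (n + suc m))
  He Es = map lift (filter (λ g → ¬? (g ≟ˢ e)) Es)
          ++ₗ map (λ i → pair w (u i)) (allFin m)
          ++ₗ map (λ i → pair (u i) (old (v i))) (allFin m)

{-# OPTIONS --safe #-}
module Submission where

-- On a Berge cycle of Hₑ every u_i is a neighbour of w: u_i lies only in {w,u_i} and
-- {u_i,v_i}, and the two cycle edges at u_i are distinct. So a cycle avoiding w uses only
-- old vertices and lifts of edges of H other than e, and is a cycle of H of the same length.
-- A cycle through w runs v_j u_j w u_i v_i; replacing this segment by the edge e, which Hₑ
-- no longer contains, gives a cycle of H three shorter. Length 3 is impossible: the vertex
-- opposite w would be both v_i and u_j.

open import Defs
open import Data.Nat using (ℕ; zero; suc; _+_; _*_; _%_; z≤n; s≤s)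
open import Data.Nat.DivMod using (m<n⇒m%n≡m; n%n≡0)
open import Data.Nat.Divisibility using (divides)
open import Data.Nat.Properties using (1+n≢n)
open import Data.Fin using (Fin; zero; suc; toℕ; fromℕ; inject₁; splitAt; _↑ʳ_; _≟_)
open import Data.Fin.Properties
  using (0≢1+n; toℕ-injective; toℕ-fromℕ<; toℕ-fromℕ; toℕ-inject₁; toℕ<n; inject₁-injective; suc-injective;
         ↑ˡ-injective; ↑ʳ-injective; splitAt-↑ˡ; splitAt-↑ʳ; splitAt⁻¹-↑ˡ; splitAt⁻¹-↑ʳ; any?)
open import Data.Fin.Induction using (<-weakInduction)
open import Data.Fin.Relation.Unary.Top using (View; view; ‵fromℕ; ‵inject₁)
open import Data.Fin.Subset using (Subset; _∈_; _∉_; outside; ⁅_⁆)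
open import Data.Fin.Subset.Properties using (x∈p∪q⁻; x∈⁅y⁆⇒x≡y)
open import Data.Vec using (replicate)
open import Data.Vec.Properties using ([]=⇒lookup; lookup⇒[]=; lookup-++ˡ; lookup-++ʳ; lookup-replicate)
open import Data.List using (List; length; lookup; map; filter; allFin)
open import Data.List.Membership.Propositional using () renaming (_∈_ to _∈ₗ_)
open import Data.List.Membership.Propositional.Properties using (∈-lookup; ∈-++⁻; ∈-map⁻; ∈-filter⁻)
open import Data.List.Relation.Unary.Any using (index)
open import Data.List.Relation.Unary.Any.Properties using (lookup-index)
open import Data.Product using (∃; ∃-syntax; Σ-syntax; _×_; _,_; proj₁; proj₂)
open import Data.Sum using (_⊎_; inj₁; inj₂; [_,_])
open import Data.Empty using (⊥)
open import Function using (_∘_; _⇔_; Equivalence)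
open import Function.Definitions using (Injective)
open import Relation.Binary.PropositionalEquality
  using (_≡_; _≢_; refl; sym; trans; cong; subst; module ≡-Reasoning)
open import Relation.Nullary using (¬_; ¬?; yes; no; contradiction)

toℕ-next : ∀ {k} (i : Fin (suc k)) → toℕ (next i) ≡ suc (toℕ i) % suc k
toℕ-next i = toℕ-fromℕ< _

next-fromℕ : ∀ k → next (fromℕ k) ≡ zero
next-fromℕ k = toℕ-injective (begin
  toℕ (next (fromℕ k))       ≡⟨ toℕ-next (fromℕ k) ⟩
  suc (toℕ (fromℕ k)) % suc k ≡⟨ cong (λ j → suc j % suc k) (toℕ-fromℕ k) ⟩
  suc k % suc k               ≡⟨ n%n≡0 (suc k) ⟩
  0                           ∎)
  where open ≡-Reasoning

next-inject₁ : ∀ {k} (i : Fin k) → next (inject₁ i) ≡ suc i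
next-inject₁ {k} i = toℕ-injective (begin
  toℕ (next (inject₁ i))        ≡⟨ toℕ-next (inject₁ i) ⟩
  suc (toℕ (inject₁ i)) % suc k ≡⟨ cong (λ j → suc j % suc k) (toℕ-inject₁ i) ⟩
  suc (toℕ i) % suc k           ≡⟨ m<n⇒m%n≡m (s≤s (toℕ<n i)) ⟩
  suc (toℕ i)                   ∎)
  where open ≡-Reasoning

next-injective : ∀ {k} → Injective _≡_ _≡_ (next {suc k})
next-injective {k} {i} {j} = by-view (view i) (view j)
  where
  by-view : ∀ {i j : Fin (suc k)} → View i → View j → next i ≡ next j → i ≡ j
  by-view ‵fromℕ       ‵fromℕ       _  = refl
  by-view ‵fromℕ       (‵inject₁ t) eq with () ← trans (sym (next-fromℕ k)) (trans eq (next-inject₁ t))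
  by-view (‵inject₁ s) ‵fromℕ       eq with () ← trans (sym (next-fromℕ k)) (trans (sym eq) (next-inject₁ s))
  by-view (‵inject₁ s) (‵inject₁ t) eq =
    cong inject₁ (suc-injective (trans (sym (next-inject₁ s)) (trans eq (next-inject₁ t))))

next≢ : ∀ {k} (i : Fin (suc (suc k))) → next i ≢ i
next≢ {k} i = by-view (view i)
  where
  by-view : ∀ {i : Fin (suc (suc k))} → View i → next i ≢ i
  by-view ‵fromℕ eq with () ← trans (sym (next-fromℕ (suc k))) eq
  by-view (‵inject₁ s) eq = 1+n≢n (trans (cong toℕ (trans (sym (next-inject₁ s)) eq)) (toℕ-inject₁ s))

prev : ∀ {k} → Fin (suc k) → Fin (suc k)
prev zero    = fromℕ _
prev (suc i) = inject₁ i

next-prev : ∀ {k} (i : Fin (suc k)) → next (prev i) ≡ i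
next-prev zero    = next-fromℕ _
next-prev (suc i) = next-inject₁ i

prev≢ : ∀ {k} (i : Fin (suc (suc k))) → prev i ≢ i
prev≢ i eq = next≢ i (trans (cong next (sym eq)) (next-prev i))

module _ {n : ℕ} {Es : List (Subset n)} {k : ℕ} where
  open BergeCycle

  rotate : BergeCycle Es (suc k) → BergeCycle Es (suc k)
  rotate C = record
    { len≥2   = len≥2 C
    ; x       = x C ∘ next
    ; f       = f C ∘ next
    ; x-inj   = next-injective ∘ x-inj C
    ; f-inj   = next-injective ∘ f-inj C
    ; x∈f     = x∈f C ∘ next
    ; xnext∈f = xnext∈f C ∘ next
    }

  rotate-to-front : (C : BergeCycle Es (suc k)) (c : Fin (suc k)) →
                    Σ[ C′ ∈ BergeCycle Es (suc k) ] x C′ zero ≡ x C c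
  rotate-to-front C c = <-weakInduction Rotatable (λ C → C , refl) step c C
    where
    Rotatable : Fin (suc k) → Set
    Rotatable c = ∀ C → Σ[ C′ ∈ BergeCycle Es (suc k) ] x C′ zero ≡ x C c
    step : ∀ i → Rotatable (inject₁ i) → Rotatable (suc i)
    step i rotatable C with rotatable (rotate C)
    ... | C′ , eq = C′ , trans eq (cong (x C) (next-inject₁ i))

module HeProperties {n m : ℕ} (Es : List (Subset n)) (e : Subset n) (v : Fin m → Fin n) where
  open Construction e v

  old-injective : ∀ {a b} → old a ≡ old b → a ≡ b
  old-injective = ↑ˡ-injective (suc m) _ _

  old≢new : ∀ {a} {j : Fin (suc m)} → old a ≢ n ↑ʳ j
  old≢new {a} {j} eq
    with () ← trans (sym (splitAt-↑ˡ n a (suc m))) (trans (cong (splitAt n) eq) (splitAt-↑ʳ n (suc m) j))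

  u-injective : ∀ {i j} → u i ≡ u j → i ≡ j
  u-injective = suc-injective ∘ ↑ʳ-injective n _ _

  w≢u : ∀ {i} → w ≢ u i
  w≢u eq with () ← ↑ʳ-injective n _ _ eq

  vertex-cases : ∀ z → (∃[ a ] z ≡ old a) ⊎ z ≡ w ⊎ (∃[ i ] z ≡ u i)
  vertex-cases z with splitAt n z in eq
  ... | inj₁ a       = inj₁ (a , sym (splitAt⁻¹-↑ˡ eq))
  ... | inj₂ zero    = inj₂ (inj₁ (sym (splitAt⁻¹-↑ʳ eq)))
  ... | inj₂ (suc i) = inj₂ (inj₂ (i , sym (splitAt⁻¹-↑ʳ eq)))

  new∉lift : ∀ {G} (j : Fin (suc m)) → n ↑ʳ j ∉ lift G
  new∉lift {G} j mem
    with () ← trans (sym (trans (lookup-++ʳ G (replicate (suc m) outside) j) (lookup-replicate j outside)))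
                    ([]=⇒lookup mem)

  ∈-lift⁻ : ∀ {G a} → old a ∈ lift G → a ∈ G
  ∈-lift⁻ {G} {a} mem =
    lookup⇒[]= a G (trans (sym (lookup-++ˡ G (replicate (suc m) outside) a)) ([]=⇒lookup mem))

  ∈-pair⁻ : ∀ {a b z} → z ∈ pair a b → z ≡ a ⊎ z ≡ b
  ∈-pair⁻ {a} {b} mem with x∈p∪q⁻ ⁅ a ⁆ ⁅ b ⁆ mem
  ... | inj₁ z∈a = inj₁ (x∈⁅y⁆⇒x≡y a z∈a)
  ... | inj₂ z∈b = inj₂ (x∈⁅y⁆⇒x≡y b z∈b)

  old∈pair⁻ : ∀ {a z} {j : Fin (suc m)} → old a ∈ pair (n ↑ʳ j) z → old a ≡ z
  old∈pair⁻ mem with ∈-pair⁻ mem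
  ... | inj₁ a≡new = contradiction a≡new old≢new
  ... | inj₂ a≡z   = a≡z

  data EdgeView : Subset (n + suc m) → Set where
    ‵lift : ∀ q → lookup Es q ≢ e → EdgeView (lift (lookup Es q))
    ‵wu   : ∀ i → EdgeView (pair w (u i))
    ‵uv   : ∀ i → EdgeView (pair (u i) (old (v i)))

  edgeView : ∀ {E} → E ∈ₗ He Es → EdgeView E
  edgeView E∈ with ∈-++⁻ (map lift (filter (λ g → ¬? (g ≟ˢ e)) Es)) E∈
  ... | inj₁ E∈lifts with ∈-map⁻ lift E∈lifts
  ...   | G , G∈ , refl with ∈-filter⁻ (λ g → ¬? (g ≟ˢ e)) {xs = Es} G∈
  ...     | G∈Es , G≢e = subst (EdgeView ∘ lift) (sym (lookup-index G∈Es))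
                           (‵lift (index G∈Es) (G≢e ∘ trans (lookup-index G∈Es)))
  edgeView E∈ | inj₂ E∈new with ∈-++⁻ (map (λ i → pair w (u i)) (allFin m)) E∈new
  ... | inj₁ E∈wu with ∈-map⁻ (λ i → pair w (u i)) E∈wu
  ...   | i , _ , refl = ‵wu i
  edgeView E∈ | inj₂ E∈new | inj₂ E∈uv with ∈-map⁻ (λ i → pair (u i) (old (v i))) E∈uv
  ...   | i , _ , refl = ‵uv i

  record LiftedEdge (E : Subset (n + suc m)) : Set where
    field
      origin   : Fin (length Es)
      origin≢e : lookup Es origin ≢ e
      ≡lift    : E ≡ lift (lookup Es origin)

  ∈-unlift : ∀ {E a} (L : LiftedEdge E) → old a ∈ E → a ∈ lookup Es (LiftedEdge.origin L)
  ∈-unlift L = ∈-lift⁻ ∘ subst (_ ∈_) (LiftedEdge.≡lift L)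

  w-neighbour : ∀ {E z} → EdgeView E → w ∈ E → z ∈ E → z ≢ w → ∃[ i ] z ≡ u i
  w-neighbour (‵lift _ _) w∈ _ _ = contradiction w∈ (new∉lift zero)
  w-neighbour (‵wu i) _ z∈ z≢w with ∈-pair⁻ z∈
  ... | inj₁ z≡w = contradiction z≡w z≢w
  ... | inj₂ z≡u = i , z≡u
  w-neighbour (‵uv i) w∈ _ _ with ∈-pair⁻ w∈
  ... | inj₁ w≡u   = contradiction w≡u w≢u
  ... | inj₂ w≡old = contradiction (sym w≡old) old≢new

  u-neighbour : ∀ {E z i} → EdgeView E → u i ∈ E → z ∈ E → z ≢ u i →
                z ≡ w ⊎ (E ≡ pair (u i) (old (v i)) × z ≡ old (v i))
  u-neighbour (‵lift _ _) u∈ _ _ = contradiction u∈ (new∉lift _)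
  u-neighbour (‵wu j) u∈ z∈ z≢u with ∈-pair⁻ u∈ | ∈-pair⁻ z∈
  ... | inj₁ u≡w | _        = contradiction (sym u≡w) w≢u
  ... | _        | inj₁ z≡w = inj₁ z≡w
  ... | inj₂ u≡u | inj₂ z≡u = contradiction (trans z≡u (sym u≡u)) z≢u
  u-neighbour (‵uv j) u∈ z∈ z≢u with ∈-pair⁻ u∈
  ... | inj₂ u≡old = contradiction (sym u≡old) old≢new
  ... | inj₁ u≡u with u-injective u≡u | ∈-pair⁻ z∈
  ...   | refl | inj₁ z≡u   = contradiction z≡u z≢u
  ...   | refl | inj₂ z≡old = inj₂ (refl , z≡old)

  old-old-edge : ∀ {E a b} → EdgeView E → old a ∈ E → old b ∈ E → a ≢ b → LiftedEdge E
  old-old-edge (‵lift q q≢e) _ _ _ = record { origin = q ; origin≢e = q≢e ; ≡lift = refl }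
  old-old-edge (‵wu i) a∈ _ _      = contradiction (old∈pair⁻ a∈) old≢new
  old-old-edge (‵uv i) a∈ b∈ a≢b   =
    contradiction (old-injective (trans (old∈pair⁻ a∈) (sym (old∈pair⁻ b∈)))) a≢b

  module OnCycle {k : ℕ} (C : BergeCycle (He Es) (suc (suc k))) where
    open BergeCycle C

    edge : ∀ t → EdgeView (lookup (He Es) (f t))
    edge t = edgeView (∈-lookup (f t))

    x-next≢ : ∀ t → x (next t) ≢ x t
    x-next≢ t = next≢ t ∘ x-inj

    x-prev≢ : ∀ t → x (prev t) ≢ x t
    x-prev≢ t = prev≢ t ∘ x-inj

    x∈f-prev : ∀ t → x t ∈ lookup (He Es) (f (prev t))
    x∈f-prev t = subst (λ s → x s ∈ lookup (He Es) (f (prev t))) (next-prev t) (xnext∈f (prev t))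

    w-position-unique : ∀ {s t} → x s ≡ w → x t ≡ w → s ≡ t
    w-position-unique xs≡w xt≡w = x-inj (trans xs≡w (sym xt≡w))

    w-next : ∀ t → x t ≡ w → ∃[ i ] x (next t) ≡ u i
    w-next t xt≡w = w-neighbour (edge t) (subst (_∈ _) xt≡w (x∈f t)) (xnext∈f t)
                                (λ eq → x-next≢ t (trans eq (sym xt≡w)))

    w-prev : ∀ t → x t ≡ w → ∃[ i ] x (prev t) ≡ u i
    w-prev t xt≡w = w-neighbour (edge (prev t)) (subst (_∈ _) xt≡w (x∈f-prev t)) (x∈f (prev t))
                                (λ eq → x-prev≢ t (trans eq (sym xt≡w)))

    u-next : ∀ t {i} → x t ≡ u i →
             x (next t) ≡ w ⊎ (lookup (He Es) (f t) ≡ pair (u i) (old (v i)) × x (next t) ≡ old (v i))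
    u-next t xt≡u = u-neighbour (edge t) (subst (_∈ _) xt≡u (x∈f t)) (xnext∈f t)
                                (λ eq → x-next≢ t (trans eq (sym xt≡u)))

    u-prev : ∀ t {i} → x t ≡ u i →
             x (prev t) ≡ w ⊎ (lookup (He Es) (f (prev t)) ≡ pair (u i) (old (v i)) × x (prev t) ≡ old (v i))
    u-prev t xt≡u = u-neighbour (edge (prev t)) (subst (_∈ _) xt≡u (x∈f-prev t)) (x∈f (prev t))
                                (λ eq → x-prev≢ t (trans eq (sym xt≡u)))

    w-adjacent : ∀ t {i} → x t ≡ u i → x (next t) ≡ w ⊎ x (prev t) ≡ w
    w-adjacent t xt≡u with u-next t xt≡u | u-prev t xt≡u
    ... | inj₁ ≡w        | _                 = inj₁ ≡w
    ... | _              | inj₁ ≡w           = inj₂ ≡w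
    ... | inj₂ (ft≡ , _) | inj₂ (fprev≡ , _) = contradiction (f-inj (trans fprev≡ (sym ft≡))) (prev≢ t)

    two-after-w : ∀ t → x t ≡ w → x (next (next t)) ≢ w → ∃[ i ] x (next (next t)) ≡ old (v i)
    two-after-w t xt≡w ≢w with w-next t xt≡w
    ... | i , xt⁺≡u with u-next (next t) xt⁺≡u
    ...   | inj₁ ≡w         = contradiction ≡w ≢w
    ...   | inj₂ (_ , ≡old) = i , ≡old

    two-before-w : ∀ t → x t ≡ w → x (prev (prev t)) ≢ w → ∃[ i ] x (prev (prev t)) ≡ old (v i)
    two-before-w t xt≡w ≢w with w-prev t xt≡w
    ... | i , xt⁻≡u with u-prev (prev t) xt⁻≡u
    ...   | inj₁ ≡w         = contradiction ≡w ≢w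
    ...   | inj₂ (_ , ≡old) = i , ≡old

    old-vertex : ∀ t → x t ≢ w → x (next t) ≢ w → x (prev t) ≢ w → ∃[ a ] x t ≡ old a
    old-vertex t ≢w ≢w⁺ ≢w⁻ with vertex-cases (x t)
    ... | inj₁ xt≡old            = xt≡old
    ... | inj₂ (inj₁ xt≡w)       = contradiction xt≡w ≢w
    ... | inj₂ (inj₂ (_ , xt≡u)) = contradiction (w-adjacent t xt≡u) [ ≢w⁺ , ≢w⁻ ]

    lifted-edge : ∀ t {a b} → x t ≡ old a → x (next t) ≡ old b → LiftedEdge (lookup (He Es) (f t))
    lifted-edge t xt≡a xt⁺≡b =
      old-old-edge (edge t) (subst (_∈ _) xt≡a (x∈f t)) (subst (_∈ _) xt⁺≡b (xnext∈f t))
        (λ a≡b → x-next≢ t (trans xt⁺≡b (trans (cong old (sym a≡b)) (sym xt≡a))))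

  unlift-cycle : ∀ {k} (C : BergeCycle (He Es) (suc (suc k))) → (∀ t → BergeCycle.x C t ≢ w) →
                 BergeCycle Es (suc (suc k))
  unlift-cycle {k} C x≢w = record
    { len≥2   = len≥2
    ; x       = y
    ; f       = origin ∘ L
    ; x-inj   = λ {s} {t} ys≡yt → x-inj (trans (x≡old s) (trans (cong old ys≡yt) (sym (x≡old t))))
    ; f-inj   = λ {s} {t} gs≡gt → f-inj (trans (≡lift (L s)) (trans (cong lift gs≡gt) (sym (≡lift (L t)))))
    ; x∈f     = λ t → ∈-unlift (L t) (subst (_∈ _) (x≡old t) (x∈f t))
    ; xnext∈f = λ t → ∈-unlift (L t) (subst (_∈ _) (x≡old (next t)) (xnext∈f t))
    }
    where
    open BergeCycle C
    open OnCycle C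
    open LiftedEdge
    old-x : ∀ t → ∃[ a ] x t ≡ old a
    old-x t = old-vertex t (x≢w t) (x≢w (next t)) (x≢w (prev t))
    y : Fin (suc (suc k)) → Fin n
    y = proj₁ ∘ old-x
    x≡old : ∀ t → x t ≡ old (y t)
    x≡old = proj₂ ∘ old-x
    L : ∀ t → LiftedEdge (lookup (He Es) (f t))
    L t = lifted-edge t (x≡old t) (x≡old (next t))

  no-triangle-through-w : (C : BergeCycle (He Es) 3) → BergeCycle.x C zero ≢ w
  no-triangle-through-w C x₀≡w with two-after-w zero x₀≡w x₂≢w | w-prev zero x₀≡w
    where
    open BergeCycle C
    open OnCycle C
    x₂≢w : x (suc (suc zero)) ≢ w
    x₂≢w x₂≡w with () ← w-position-unique x₂≡w x₀≡w
  ... | _ , x₂≡old | _ , x₂≡u = contradiction (trans (sym x₂≡old) x₂≡u) old≢new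

  module Shortcut (e∈Es : e ∈ₗ Es) (v∈e : ∀ i → v i ∈ e)
                  {k : ℕ} (C : BergeCycle (He Es) (3 + (2 + k))) (x₀≡w : BergeCycle.x C zero ≡ w) where
    open BergeCycle C
    open OnCycle C
    open LiftedEdge

    -- The short cycle keeps positions 2, …, ℓ-2 of the long one: w is at 0 and its neighbours
    -- u_i, u_j at 1 and ℓ-1. Its last edge, from v_j back to v_i, is e.
    P : Fin (2 + k) → Fin (3 + (2 + k))
    P t = suc (suc (inject₁ t))

    P-injective : ∀ {s t} → P s ≡ P t → s ≡ t
    P-injective = inject₁-injective ∘ suc-injective ∘ suc-injective

    x≢w : ∀ {t} → t ≢ zero → x t ≢ w
    x≢w t≢0 xt≡w = t≢0 (w-position-unique xt≡w x₀≡w)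

    old-P : ∀ t → ∃[ a ] x (P t) ≡ old a
    old-P t = old-vertex (P t) (x≢w λ ()) (x≢w (λ eq → 0≢1+n (trans (sym eq) (next-inject₁ (suc (suc t))))))
                         (x≢w λ ())

    next-P : ∀ s → next (P (inject₁ s)) ≡ P (suc s)
    next-P s = next-inject₁ (suc (suc (inject₁ s)))

    y : Fin (2 + k) → Fin n
    y = proj₁ ∘ old-P

    x≡old : ∀ t → x (P t) ≡ old (y t)
    x≡old = proj₂ ∘ old-P

    x-next≡old : ∀ s → x (next (P (inject₁ s))) ≡ old (y (suc s))
    x-next≡old s = trans (cong x (next-P s)) (x≡old (suc s))

    y∈e : ∀ {t i} → x (P t) ≡ old (v i) → y t ∈ e
    y∈e {t} {i} eq = subst (_∈ e) (old-injective (trans (sym eq) (x≡old t))) (v∈e i)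

    y-first∈e : y zero ∈ e
    y-first∈e = y∈e (proj₂ (two-after-w zero x₀≡w (x≢w λ ())))

    y-last∈e : y (fromℕ (suc k)) ∈ e
    y-last∈e = y∈e (proj₂ (two-before-w zero x₀≡w (x≢w λ ())))

    lifted : ∀ s → LiftedEdge (lookup (He Es) (f (P (inject₁ s))))
    lifted s = lifted-edge (P (inject₁ s)) (x≡old (inject₁ s)) (x-next≡old s)

    y∈lifted : ∀ s {r t} → x r ≡ old (y t) → x r ∈ lookup (He Es) (f (P (inject₁ s))) →
               y t ∈ lookup Es (origin (lifted s))
    y∈lifted s xr≡old = ∈-unlift (lifted s) ∘ subst (_∈ lookup (He Es) (f (P (inject₁ s)))) xr≡old

    e-index : Fin (length Es)
    e-index = index e∈Es

    lookup-e-index : lookup Es e-index ≡ e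
    lookup-e-index = sym (lookup-index e∈Es)

    edge′ : ∀ {t : Fin (2 + k)} → View t → Fin (length Es)
    edge′ ‵fromℕ        = e-index
    edge′ (‵inject₁ s) = origin (lifted s)

    edge′-injective : ∀ {s t} (vs : View s) (vt : View t) →
                      lookup Es (edge′ vs) ≡ lookup Es (edge′ vt) → s ≡ t
    edge′-injective ‵fromℕ       ‵fromℕ       _  = refl
    edge′-injective ‵fromℕ       (‵inject₁ t) eq =
      contradiction (trans (sym eq) lookup-e-index) (origin≢e (lifted t))
    edge′-injective (‵inject₁ s) ‵fromℕ       eq =
      contradiction (trans eq lookup-e-index) (origin≢e (lifted s))
    edge′-injective (‵inject₁ s) (‵inject₁ t) eq =
      P-injective (f-inj (trans (≡lift (lifted s)) (trans (cong lift eq) (sym (≡lift (lifted t))))))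

    y∈edge′ : ∀ {t} (vt : View t) → y t ∈ lookup Es (edge′ vt)
    y∈edge′ ‵fromℕ       = subst (y (fromℕ (suc k)) ∈_) (sym lookup-e-index) y-last∈e
    y∈edge′ (‵inject₁ s) = y∈lifted s (x≡old (inject₁ s)) (x∈f (P (inject₁ s)))

    ynext∈edge′ : ∀ {t} (vt : View t) → y (next t) ∈ lookup Es (edge′ vt)
    ynext∈edge′ ‵fromℕ = subst (λ r → y r ∈ lookup Es e-index) (sym (next-fromℕ (suc k)))
                           (subst (y zero ∈_) (sym lookup-e-index) y-first∈e)
    ynext∈edge′ (‵inject₁ s) =
      subst (λ r → y r ∈ lookup Es (origin (lifted s))) (sym (next-inject₁ s))
        (y∈lifted s (x-next≡old s) (xnext∈f (P (inject₁ s))))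

    shortcut : BergeCycle Es (2 + k)
    shortcut = record
      { len≥2   = s≤s (s≤s z≤n)
      ; x       = y
      ; f       = edge′ ∘ view
      ; x-inj   = λ {s} {t} ys≡yt →
                    P-injective (x-inj (trans (x≡old s) (trans (cong old ys≡yt) (sym (x≡old t)))))
      ; f-inj   = λ {s} {t} → edge′-injective (view s) (view t)
      ; x∈f     = y∈edge′ ∘ view
      ; xnext∈f = ynext∈edge′ ∘ view
      }

corollary5p3 : (n m : ℕ) (Es : List (Subset n)) → IsHypergraph Es →
    (e : Subset n) → e ∈ₗ Es →
    (v : Fin m → Fin n) → Injective _≡_ _≡_ v → (∀ y → (y ∈ e) ⇔ ∃ (λ i → v i ≡ y)) →
    ¬ HasCycleDiv3 Es → ¬ HasCycleDiv3 (Construction.He e v Es)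
corollary5p3 n m Es _ e e∈Es v _ e≡image noCycle (ℓ , divides q ℓ≡q*3 , C) =
  no-cycle-of-length q (subst (BergeCycle (He Es)) ℓ≡q*3 C)
  where
  open Construction e v
  open HeProperties Es e v
  v∈e : ∀ i → v i ∈ e
  v∈e i = Equivalence.from (e≡image (v i)) (i , refl)
  no-cycle-in-H : ∀ q → BergeCycle Es (q * 3) → ⊥
  no-cycle-in-H q C = noCycle (q * 3 , divides q refl , C)
  no-cycle-of-length : ∀ q → BergeCycle (He Es) (q * 3) → ⊥
  no-cycle-of-length zero C with () ← BergeCycle.len≥2 C
  no-cycle-of-length (suc q) C with any? (λ t → BergeCycle.x C t ≟ w)
  ... | no w∉C = no-cycle-in-H (suc q) (unlift-cycle C (λ t xt≡w → w∉C (t , xt≡w)))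
  ... | yes (c , xc≡w) with rotate-to-front C c
  ...   | C′ , x₀≡xc with q
  ...     | zero   = no-triangle-through-w C′ (trans x₀≡xc xc≡w)
  ...     | suc q′ = no-cycle-in-H (suc q′) (Shortcut.shortcut e∈Es v∈e C′ (trans x₀≡xc xc≡w))
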